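{- Let $\mathcal{F}$ be a Veltman frame with ultrafilter extension $\mathcal{F}^{ue}=\langle W^{ue},R^{ue},\{S^{ue}_a\}_{a\in W^{ue}}\rangle$. If $\langle f,\sigma\rangle,\langle g,\tau\rangle\in W^{ue}$ and $\langle f,\sigma\rangle R^{ue}\langle g,\tau\rangle$, then $\sigma$ is a proper initial segment of $\tau$ and there is a proper filter $l$ on $W$ with $f\prec_l g$.
   Context: A Veltman frame is $\mathcal{F}=\langle W,R,\{S_w\}_{w\in W}\rangle$ where: - $W$ is nonempty. - $R$ is transitive and conversely well-founded. - Each $S_w$ is a reflexive transitive relation on $R[w]=\{v:wRv\}$ containing $R\cap R[w]^2$. For $X,Y\subseteq W$: - $\overline{Y}=W\setminus Y$. - $\widehat{R^{ -1}}(Y)=\{x:\forall y(xRy\to y\in Y)\}$. - $S^{ -1}(X,Y)=\{w:\forall x\in X(wRx\to\exists y\in Y\,xS_wy)\}$. $U(W)$ is the set of ultrafilters on $W$. A proper filter is a filter not containing $\emptyset$. For a family $l\subseteq\wp(W)$ (labels $l$ in the construction below are taken $\subseteq\wp(W)\setminus\{\emptyset\}$ with the finite intersection property) and $f,g\in U(W)$, $f\prec_l g$ means the following: for every $A\subseteq W$ and every finite (possibly empty) family $S_1,\dots,S_n\in l$, if $S^{ -1}(\overline{A},\overline{S_1}\cup\dots\cup\overline{S_n})\in f$ then $A,\widehat{R^{ -1}}(A)\in g$. Ultrafilter extension: - $W^{ue}$ is the smallest set of pairs $\langle f,\sigma\rangle$ ($f\in U(W)$, $\sigma$ a finite sequence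 of labels) containing $\langle f,\langle\rangle\rangle$ for all $f\in U(W)$, and containing $\langle g,\sigma^\frown\langle l\rangle\rangle$ whenever $\langle f,\sigma\rangle\in W^{ue}$ and $f\prec_l g$. - $R^{ue}$ is the transitive closure of the relation $R^{ue}_{one}$ given by $\langle f,\sigma\rangle R^{ue}_{one}\langle g,\sigma^\frown\langle l\rangle\rangle$ iff $f\prec_l g$. - $S^{ue}_{\langle f,\sigma\rangle}$ is the smallest reflexive transitive relation on $R^{ue}[\langle f,\sigma\rangle]$ that contains $R^{ue}\cap R^{ue}[\langle f,\sigma\rangle]^2$ and contains all pairs of $R^{ue}$-successors of $\langle f,\sigma\rangle$ whose sequences agree at the entry immediately following $\sigma$. -}

module Defs where

open import Level using (Level; 0ℓ) renaming (suc to lsuc)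
open import Data.Empty using (⊥)
open import Data.Unit using (⊤)
open import Data.Product using (Σ; Σ-syntax; ∃; _×_; _,_)
open import Data.Sum using (_⊎_)
open import Data.List using (List; []; _∷_; _++_; _∷ʳ_)
open import Data.List.Relation.Unary.All using (All)
open import Data.List.Relation.Unary.Any using (Any)
open import Relation.Nullary using (¬_)
open import Relation.Binary.PropositionalEquality using (_≡_; _≢_)
open import Induction.WellFounded using (WellFounded)
open import Relation.Binary.Construct.Closure.Transitive using (TransClosure)

Subset : Set → Set₁
Subset W = W → Set

Family : Set → Set₁
Family W = Subset W → Set

module _ {W : Set} where
  _⊆_ : Subset W → Subset W → Set
  A ⊆ B = ∀ x → A x → B x

  ∅ : Subset W
  ∅ = λ _ → ⊥

  full : Subset W
  full = λ _ → ⊤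

  co : Subset W → Subset W
  co Y = λ x → ¬ Y x

  _∩_ : Subset W → Subset W → Subset W
  A ∩ B = λ x → A x × B x

  ⋂ : List (Subset W) → Subset W
  ⋂ []       = full
  ⋂ (S ∷ Ss) = S ∩ ⋂ Ss

  ⋃co : List (Subset W) → Subset W
  ⋃co []       = ∅
  ⋃co (S ∷ Ss) = λ x → co S x ⊎ ⋃co Ss x

  Nonempty : Subset W → Set
  Nonempty A = Σ W A

  record IsFilter (F : Family W) : Set₁ where
    field
      hasFull  : F full
      upward   : ∀ {A B} → A ⊆ B → F A → F B
      meet     : ∀ {A B} → F A → F B → F (A ∩ B)

  record IsProperFilter (F : Family W) : Set₁ where
    field
      isFilter : IsFilter F
      proper   : ¬ F ∅

  record IsUltrafilter (F : Family W) : Set₁ where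
    field
      isProperFilter : IsProperFilter F
      ultra          : ∀ A → F A ⊎ F (co A)

  record IsLabel (l : Family W) : Set₁ where
    field
      nonemptyMembers : ∀ S → l S → Nonempty S
      fip             : ∀ (Ss : List (Subset W)) → All l Ss → Nonempty (⋂ Ss)

record VeltmanFrame : Set₁ where
  field
    W        : Set
    inhabited : W
    R        : W → W → Set
    R-trans  : ∀ {x y z} → R x y → R y z → R x z
    R-cwf    : WellFounded (λ x y → R y x)
    S        : W → W → W → Set               -- S w x y  means  x S_w y
    S-dom    : ∀ {w x y} → S w x y → R w x × R w y
    S-refl   : ∀ {w x} → R w x → S w x x
    S-trans  : ∀ {w x y z} → S w x y → S w y z → S w x z
    S-R      : ∀ {w x y} → R w x → R w y → R x y → S w x y

module UE (F : VeltmanFrame) where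
  open VeltmanFrame F

  Rhat⁻¹ : Subset W → Subset W
  Rhat⁻¹ Y = λ x → ∀ y → R x y → Y y

  S⁻¹ : Subset W → Subset W → Subset W
  S⁻¹ X Y = λ w → ∀ x → X x → R w x → Σ[ y ∈ W ] (Y y × S w x y)

  _≺[_]_ : Family W → Family W → Family W → Set₁
  f ≺[ l ] g = ∀ (A : Subset W) (Ss : List (Subset W)) → All l Ss →
               f (S⁻¹ (co A) (⋃co Ss)) → g A × g (Rhat⁻¹ A)

  Point : Set₁
  Point = Family W × List (Family W)

  data Wue : Point → Set₁ where
    root : ∀ {f} → IsUltrafilter f → Wue (f , [])
    step : ∀ {f σ g l} → Wue (f , σ) → IsUltrafilter g → IsLabel l →
           f ≺[ l ] g → Wue (g , σ ∷ʳ l)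

  data Rone : Point → Point → Set₁ where
    one : ∀ {f σ g l} → IsUltrafilter f → IsUltrafilter g → IsLabel l →
          f ≺[ l ] g → Rone (f , σ) (g , σ ∷ʳ l)

  Rue : Point → Point → Set₁
  Rue = TransClosure Rone

ProperPrefix : {A : Set₁} → List A → List A → Set₁
ProperPrefix σ τ = Σ[ ρ ∈ _ ] (ρ ≢ [] × τ ≡ σ ++ ρ)

{-# OPTIONS --safe #-}
-- Every R^ue-step appends one label, so along an R^ue-path the sequence grows by a
-- nonempty block.  For the filter take the principal filter {W}: all its members are W,
-- so f ≺_{W} g only asks that S⁻¹(co A, ∅) ∈ f imply A, R̂⁻¹(A) ∈ g.  Every step f ≺_l h
-- gives this (take no labels), and it composes along paths because R̂⁻¹(A) ⊆ S⁻¹(co A, ∅):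
-- a point without R-successors outside A vacuously lies in S⁻¹(co A, ∅).
module Submission where

open import Defs
open import Data.Empty using (⊥-elim)
open import Data.List using (List; []; _∷_; _++_; _∷ʳ_)
open import Data.List.Properties using (++-assoc; ++-conicalˡ)
open import Data.List.Relation.Unary.All using (All; []; _∷_)
open import Data.Product using (Σ-syntax; _×_; _,_; proj₂)
open import Data.Sum using (inj₁; inj₂)
open import Data.Unit using (tt)
open import Relation.Binary.PropositionalEquality using (refl)
open import Relation.Binary.Construct.Closure.Transitive using ([_]; _∷_)

ProperPrefix-∷ʳ : {A : Set₁} (xs : List A) (x : A) → ProperPrefix xs (xs ∷ʳ x)
ProperPrefix-∷ʳ xs x = x ∷ [] , (λ ()) , refl

ProperPrefix-trans : {A : Set₁} {xs ys zs : List A} →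
                     ProperPrefix xs ys → ProperPrefix ys zs → ProperPrefix xs zs
ProperPrefix-trans {xs = xs} (ρ , ρ≢[] , refl) (ρ′ , _ , refl) =
  ρ ++ ρ′ , (λ eq → ρ≢[] (++-conicalˡ ρ ρ′ eq)) , ++-assoc xs ρ ρ′

module _ {W : Set} where

  IsUltrafilter⇒IsFilter : {f : Family W} → IsUltrafilter f → IsFilter f
  IsUltrafilter⇒IsFilter uf = IsProperFilter.isFilter (IsUltrafilter.isProperFilter uf)

  principal : Subset W → Family W
  principal X A = X ⊆ A

  principal-isProperFilter : {X : Subset W} → Nonempty X → IsProperFilter (principal X)
  principal-isProperFilter (x , Xx) = record
    { isFilter = record
      { hasFull = λ _ _ → tt
      ; upward  = λ A⊆B X⊆A y Xy → A⊆B y (X⊆A y Xy)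
      ; meet    = λ X⊆A X⊆B y Xy → X⊆A y Xy , X⊆B y Xy
      }
    ; proper  = λ X⊆∅ → X⊆∅ x Xx
    }

  ⋃co-principal-full : ∀ Ss → All (principal full) Ss → ⋃co Ss ⊆ ∅
  ⋃co-principal-full (S ∷ Ss) (W⊆S ∷ _)  y (inj₁ ¬Sy) = ¬Sy (W⊆S y tt)
  ⋃co-principal-full (S ∷ Ss) (_ ∷ all) y (inj₂ y∈⋃) = ⋃co-principal-full Ss all y y∈⋃

module _ (F : VeltmanFrame) where
  open VeltmanFrame F
  open UE F

  Wue⇒IsUltrafilter : ∀ {f σ} → Wue (f , σ) → IsUltrafilter f
  Wue⇒IsUltrafilter (root uf)       = uf
  Wue⇒IsUltrafilter (step _ ug _ _) = ug

  Rue⇒ProperPrefix : ∀ {f g σ τ} → Rue (f , σ) (g , τ) → ProperPrefix σ τ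
  Rue⇒ProperPrefix [ one {σ = σ} {l = l} _ _ _ _ ]   = ProperPrefix-∷ʳ σ l
  Rue⇒ProperPrefix (one {σ = σ} {l = l} _ _ _ _ ∷ r) =
    ProperPrefix-trans (ProperPrefix-∷ʳ σ l) (Rue⇒ProperPrefix r)

  S⁻¹-monoʳ : ∀ {X Y Y′} → Y ⊆ Y′ → S⁻¹ X Y ⊆ S⁻¹ X Y′
  S⁻¹-monoʳ Y⊆Y′ w w∈S⁻¹ x Xx wRx =
    let (y , Yy , xSy) = w∈S⁻¹ x Xx wRx in y , Y⊆Y′ y Yy , xSy

  Rhat⁻¹⊆S⁻¹-co-∅ : ∀ A → Rhat⁻¹ A ⊆ S⁻¹ (co A) ∅
  Rhat⁻¹⊆S⁻¹-co-∅ A w w∈Rhat x ¬Ax wRx = ⊥-elim (¬Ax (w∈Rhat x wRx))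

  -- the instance of f ≺[ l ] g with no labels S₁, …, Sₙ; it does not depend on l
  record _≺₀_ (f g : Family W) : Set₁ where
    constructor mk≺₀
    field apply : ∀ A → f (S⁻¹ (co A) ∅) → g A × g (Rhat⁻¹ A)

  ≺⇒≺₀ : ∀ {f l g} → f ≺[ l ] g → f ≺₀ g
  ≺⇒≺₀ f≺g = mk≺₀ (λ A → f≺g A [] [])

  ≺₀-trans : ∀ {f h g} → IsFilter h → f ≺₀ h → h ≺₀ g → f ≺₀ g
  ≺₀-trans h-filter (mk≺₀ f≺h) (mk≺₀ h≺g) = mk≺₀ λ A fA →
    h≺g A (IsFilter.upward h-filter (Rhat⁻¹⊆S⁻¹-co-∅ A) (proj₂ (f≺h A fA)))

  ≺₀⇒≺-principal-full : ∀ {f g} → IsFilter f → f ≺₀ g → f ≺[ principal full ] g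
  ≺₀⇒≺-principal-full f-filter (mk≺₀ f≺g) A Ss all fA =
    f≺g A (IsFilter.upward f-filter (S⁻¹-monoʳ (⋃co-principal-full Ss all)) fA)

  Rue⇒≺₀ : ∀ {f g σ τ} → Rue (f , σ) (g , τ) → f ≺₀ g
  Rue⇒≺₀ [ one _ _ _ f≺g ]       = ≺⇒≺₀ f≺g
  Rue⇒≺₀ (one _ uh _ f≺h ∷ h⁺g) =
    ≺₀-trans (IsUltrafilter⇒IsFilter uh) (≺⇒≺₀ f≺h) (Rue⇒≺₀ h⁺g)

lemma5p5 : (F : VeltmanFrame) → let open VeltmanFrame F in let open UE F in
    ∀ {f g : Family W} {σ τ : List (Family W)} →
    Wue (f , σ) → Wue (g , τ) → Rue (f , σ) (g , τ) →
    ProperPrefix σ τ × Σ[ l ∈ Family W ] (IsProperFilter l × f ≺[ l ] g)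
lemma5p5 F wf _ r =
  Rue⇒ProperPrefix F r ,
  principal full ,
  principal-isProperFilter (inhabited , tt) ,
  ≺₀⇒≺-principal-full F (IsUltrafilter⇒IsFilter (Wue⇒IsUltrafilter F wf)) (Rue⇒≺₀ F r)
  where open VeltmanFrame F using (inhabited)
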